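{- Let $f(x),g(x)\in\mathbb{Z}[x]$ be polynomials of positive degree having no common complex root, and let $d=\gcd(L(f),L(g))$. Then $d\,B(f,g)\mid R(f,g)$.
   Context: $L(h)$ denotes the leading coefficient of $h\in\mathbb{Z}[x]$. There are unique $p,q\in\mathbb{Q}[x]$ with $pf+qg=1$, $\deg p<\deg g$, $\deg q<\deg f$; $B(f,g)$ is the least common multiple of the denominators (in lowest terms) of all coefficients of these $p$ and $q$. $R(f,g)=|\mathrm{Res}(f,g)|$, the absolute value of the resultant of $f$ and $g$. -}

module Defs where

open import Data.Nat as ℕ using (ℕ; zero; suc; _∸_; _≤ᵇ_)
open import Data.Nat.GCD using (gcd)
open import Data.Nat.LCM using (lcm)
open import Data.Integer as ℤ using (ℤ; +_)
open import Data.Rational as ℚ using (ℚ; 0ℚ; 1ℚ)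
open import Data.Fin using (Fin; zero; suc; toℕ; punchIn)
open import Data.Vec using (Vec; []; _∷_; last; toList)
open import Data.List using (List; foldr; map)
open import Data.Bool using (if_then_else_)

-- A polynomial of formal degree m over a type A is a vector of its
-- coefficients a₀ , a₁ , … , aₘ (ascending order), i.e. Vec A (suc m).
-- Coefficient of x^k (zero beyond the stored range).
coeff : ∀ {A : Set} → A → ∀ {k} → Vec A k → ℕ → A
coeff z []       _       = z
coeff z (a ∷ as) zero    = a
coeff z (a ∷ as) (suc i) = coeff z as i

coeffℤ : ∀ {k} → Vec ℤ k → ℕ → ℤ
coeffℤ = coeff (+ 0)

coeffℚ : ∀ {k} → Vec ℚ k → ℕ → ℚ
coeffℚ = coeff 0ℚ

L : ∀ {m} → Vec ℤ (suc m) → ℤ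
L = last

altSum : (n : ℕ) → (Fin n → ℤ) → ℤ
altSum zero    h = + 0
altSum (suc n) h = h zero ℤ.- altSum n (λ j → h (suc j))

det : (n : ℕ) → (Fin n → Fin n → ℤ) → ℤ
det zero    M = + 1
det (suc n) M = altSum (suc n) (λ j → M zero j ℤ.* det n (λ i k → M (suc i) (punchIn j k)))

-- Rows 0..n-1: shifted coefficients of f; rows n..n+m-1:
-- shifted coefficients of g. (Ascending-coefficient layout; it differs
-- from the usual one by row/column permutations, so |det| is unchanged.)

shifted : ∀ {k} → Vec ℤ k → ℕ → ℕ → ℤ
shifted a i j = if i ≤ᵇ j then coeffℤ a (j ∸ i) else + 0

sylvester : ∀ {m n} → Vec ℤ (suc m) → Vec ℤ (suc n) → Fin (n ℕ.+ m) → Fin (n ℕ.+ m) → ℤ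
sylvester {m} {n} f g i j =
  if suc (toℕ i) ≤ᵇ n
  then shifted f (toℕ i) (toℕ j)
  else shifted g (toℕ i ∸ n) (toℕ j)

Res : ∀ {m n} → Vec ℤ (suc m) → Vec ℤ (suc n) → ℤ
Res {m} {n} f g = det (n ℕ.+ m) (sylvester f g)

R : ∀ {m n} → Vec ℤ (suc m) → Vec ℤ (suc n) → ℕ
R f g = ℤ.∣ Res f g ∣

toℚ : ℤ → ℚ
toℚ z = z ℚ./ 1

sumTo : ℕ → (ℕ → ℚ) → ℚ
sumTo zero    h = h 0
sumTo (suc k) h = sumTo k h ℚ.+ h (suc k)

convCoeff : (ℕ → ℚ) → (ℕ → ℚ) → ℕ → ℚ
convCoeff a b k = sumTo k (λ i → a i ℚ.* b (k ∸ i))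

oneCoeff : ℕ → ℚ
oneCoeff zero    = 1ℚ
oneCoeff (suc _) = 0ℚ

IsBezout : ∀ {m n} → Vec ℤ (suc m) → Vec ℤ (suc n) → Vec ℚ n → Vec ℚ m → Set
IsBezout f g p q =
  ∀ k → convCoeff (coeffℚ p) (λ i → toℚ (coeffℤ f i)) k
        ℚ.+ convCoeff (coeffℚ q) (λ i → toℚ (coeffℤ g i)) k
        ≡ oneCoeff k
  where open import Relation.Binary.PropositionalEquality using (_≡_)

lcmDen : List ℚ → ℕ
lcmDen = foldr (λ r acc → lcm (ℚ.denominatorℕ r) acc) 1

B : ∀ {m n} → Vec ℚ n → Vec ℚ m → ℕ
B p q = lcm (lcmDen (toList p)) (lcmDen (toList q))

-- With S the Sylvester matrix of f and g, the identity p f + q g = 1 says that the row vector x of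
-- coefficients of p followed by those of q satisfies x S = (1, 0, …, 0). By Cramer's rule
-- x_j · Res f g = det T_j, where T_j is S with row j replaced by (1, 0, …, 0). Since deg f, deg g ≥ 1,
-- the last column of S and of every T_j holds only leading coefficients of f and g and zeros, so
-- d = gcd (L f) (L g) divides Res f g = A d and det T_j = b_j d. Hence x_j · A = b_j is an integer,
-- every denominator of p and q divides A, so B p q ∣ A and d · B p q ∣ |A d| = R f g.
{-# OPTIONS --safe #-}
module Submission where

open import Defs
open import Relation.Binary.PropositionalEquality
open import Function using (_∘_)

module ToℚProperties where
  import Data.Integer as ℤ
  open import Data.Integer.Properties using (*-identityʳ)
  open import Data.Rational using (_+_; _*_; -_; _-_; toℚᵘ)
  open import Data.Rational.Properties
    using (toℚᵘ-injective; toℚᵘ-fromℚᵘ; toℚᵘ-homo-+; toℚᵘ-homo-*; toℚᵘ-homo‿-)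
  open import Data.Rational.Unnormalised as ℚᵘ using (mkℚᵘ; _≃_; *≡*)
  open import Data.Rational.Unnormalised.Properties
    using (+-cong; *-cong; -‿cong; module ≃-Reasoning)
  open ≃-Reasoning

  toℚᵘ-toℚ : ∀ z → toℚᵘ (toℚ z) ≃ mkℚᵘ z 0
  toℚᵘ-toℚ z = toℚᵘ-fromℚᵘ (mkℚᵘ z 0)

  toℚ-+ : ∀ a b → toℚ (a ℤ.+ b) ≡ toℚ a + toℚ b
  toℚ-+ a b = toℚᵘ-injective (begin
    toℚᵘ (toℚ (a ℤ.+ b))            ≈⟨ toℚᵘ-toℚ (a ℤ.+ b) ⟩
    mkℚᵘ (a ℤ.+ b) 0                ≈⟨ *≡* (cong (ℤ._* ℤ.1ℤ) (sym (cong₂ ℤ._+_ (*-identityʳ a) (*-identityʳ b)))) ⟩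
    mkℚᵘ a 0 ℚᵘ.+ mkℚᵘ b 0          ≈⟨ +-cong (toℚᵘ-toℚ a) (toℚᵘ-toℚ b) ⟨
    toℚᵘ (toℚ a) ℚᵘ.+ toℚᵘ (toℚ b)  ≈⟨ toℚᵘ-homo-+ (toℚ a) (toℚ b) ⟨
    toℚᵘ (toℚ a + toℚ b)            ∎)

  toℚ-* : ∀ a b → toℚ (a ℤ.* b) ≡ toℚ a * toℚ b
  toℚ-* a b = toℚᵘ-injective (begin
    toℚᵘ (toℚ (a ℤ.* b))            ≈⟨ toℚᵘ-toℚ (a ℤ.* b) ⟩
    mkℚᵘ a 0 ℚᵘ.* mkℚᵘ b 0          ≈⟨ *-cong (toℚᵘ-toℚ a) (toℚᵘ-toℚ b) ⟨
    toℚᵘ (toℚ a) ℚᵘ.* toℚᵘ (toℚ b)  ≈⟨ toℚᵘ-homo-* (toℚ a) (toℚ b) ⟨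
    toℚᵘ (toℚ a * toℚ b)            ∎)

  toℚ-neg : ∀ a → toℚ (ℤ.- a) ≡ - toℚ a
  toℚ-neg a = toℚᵘ-injective (begin
    toℚᵘ (toℚ (ℤ.- a))   ≈⟨ toℚᵘ-toℚ (ℤ.- a) ⟩
    ℚᵘ.- mkℚᵘ a 0        ≈⟨ -‿cong (toℚᵘ-toℚ a) ⟨
    ℚᵘ.- toℚᵘ (toℚ a)    ≈⟨ toℚᵘ-homo‿- (toℚ a) ⟨
    toℚᵘ (- toℚ a)       ∎)

  toℚ-sub : ∀ a b → toℚ (a ℤ.- b) ≡ toℚ a - toℚ b
  toℚ-sub a b = trans (toℚ-+ a (ℤ.- b)) (cong (toℚ a +_) (toℚ-neg b))

module Summation where
  open import Data.Nat as ℕ using (ℕ; zero; suc; _<_; _≤_)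
  import Data.Nat.Properties as ℕₚ
  open import Data.Rational using (ℚ; 0ℚ; _+_; _*_; -_)
  open import Data.Rational.Properties
    using (+-assoc; +-comm; +-identityˡ; +-identityʳ; *-zeroʳ; *-distribˡ-+; neg-distrib-+)
  open import Data.Rational.Solver using (module +-*-Solver)
  open +-*-Solver
  open import Relation.Nullary using (yes; no)
  open ≡-Reasoning

  ∑ : ℕ → (ℕ → ℚ) → ℚ
  ∑ zero    h = 0ℚ
  ∑ (suc n) h = ∑ n h + h n

  syntax ∑ n (λ i → e) = ∑[ i < n ] e

  ∑-cong : ∀ n {f g : ℕ → ℚ} → (∀ i → i < n → f i ≡ g i) → ∑ n f ≡ ∑ n g
  ∑-cong zero    f≗g = refl
  ∑-cong (suc n) f≗g =
    cong₂ _+_ (∑-cong n (λ i i<n → f≗g i (ℕₚ.m<n⇒m<1+n i<n))) (f≗g n (ℕₚ.n<1+n n))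

  ∑-zero : ∀ n (f : ℕ → ℚ) → (∀ i → i < n → f i ≡ 0ℚ) → ∑ n f ≡ 0ℚ
  ∑-zero n f f≗0 = trans (∑-cong n f≗0) (∑-const-0 n)
    where
    ∑-const-0 : ∀ n → ∑[ i < n ] 0ℚ ≡ 0ℚ
    ∑-const-0 zero    = refl
    ∑-const-0 (suc n) = cong (_+ 0ℚ) (∑-const-0 n)

  ∑-distrib-+ : ∀ n (f g : ℕ → ℚ) → ∑[ i < n ] (f i + g i) ≡ ∑ n f + ∑ n g
  ∑-distrib-+ zero    f g = refl
  ∑-distrib-+ (suc n) f g = begin
    ∑[ i < n ] (f i + g i) + (f n + g n)  ≡⟨ cong (_+ (f n + g n)) (∑-distrib-+ n f g) ⟩
    (∑ n f + ∑ n g) + (f n + g n)         ≡⟨ solve 4 (λ F G x y → (F :+ G) :+ (x :+ y) := (F :+ x) :+ (G :+ y))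
                                                     refl (∑ n f) (∑ n g) (f n) (g n) ⟩
    (∑ n f + f n) + (∑ n g + g n)         ∎

  ∑-*ˡ : ∀ n c (f : ℕ → ℚ) → ∑[ i < n ] (c * f i) ≡ c * ∑ n f
  ∑-*ˡ zero    c f = sym (*-zeroʳ c)
  ∑-*ˡ (suc n) c f = trans (cong (_+ c * f n) (∑-*ˡ n c f)) (sym (*-distribˡ-+ c (∑ n f) (f n)))

  ∑-neg : ∀ n (f : ℕ → ℚ) → ∑[ i < n ] (- f i) ≡ - ∑ n f
  ∑-neg zero    f = refl
  ∑-neg (suc n) f = trans (cong (_+ - f n) (∑-neg n f)) (sym (neg-distrib-+ (∑ n f) (f n)))

  ∑-head : ∀ n (f : ℕ → ℚ) → ∑ (suc n) f ≡ f 0 + ∑[ i < n ] f (suc i)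
  ∑-head zero    f = +-comm 0ℚ (f 0)
  ∑-head (suc n) f = trans (cong (_+ f (suc n)) (∑-head n f)) (+-assoc (f 0) _ _)

  ∑-swap : ∀ n m (h : ℕ → ℕ → ℚ) → ∑[ a < n ] ∑[ b < m ] h a b ≡ ∑[ b < m ] ∑[ a < n ] h a b
  ∑-swap zero    m h = sym (∑-zero m _ (λ _ _ → refl))
  ∑-swap (suc n) m h =
    trans (cong (_+ ∑ m (h n)) (∑-swap n m h)) (sym (∑-distrib-+ m (λ b → ∑[ a < n ] h a b) (h n)))

  ∑-split : ∀ n m (h : ℕ → ℚ) → ∑ (n ℕ.+ m) h ≡ ∑ n h + ∑[ r < m ] h (n ℕ.+ r)
  ∑-split n zero h rewrite ℕₚ.+-identityʳ n = sym (+-identityʳ (∑ n h))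
  ∑-split n (suc m) h rewrite ℕₚ.+-suc n m =
    trans (cong (_+ h (n ℕ.+ m)) (∑-split n m h)) (+-assoc (∑ n h) _ _)

  ∑-vanishing-tail : ∀ n k (h : ℕ → ℚ) → (∀ r → n ≤ r → h r ≡ 0ℚ) → ∑ (n ℕ.+ k) h ≡ ∑ n h
  ∑-vanishing-tail n k h tail≗0 = begin
    ∑ (n ℕ.+ k) h                     ≡⟨ ∑-split n k h ⟩
    ∑ n h + ∑[ r < k ] h (n ℕ.+ r)    ≡⟨ cong (∑ n h +_) (∑-zero k _ (λ r _ → tail≗0 _ (ℕₚ.m≤m+n n r))) ⟩
    ∑ n h + 0ℚ                        ≡⟨ +-identityʳ (∑ n h) ⟩
    ∑ n h                             ∎

  ∑-single : ∀ n (h : ℕ → ℚ) j → j < n → (∀ r → r < n → r ≢ j → h r ≡ 0ℚ) → ∑ n h ≡ h j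
  ∑-single (suc n) h j j<1+n others≗0 with j ℕ.≟ n
  ... | yes refl = begin
    ∑ n h + h j  ≡⟨ cong (_+ h j) (∑-zero n h below-j≗0) ⟩
    0ℚ + h j     ≡⟨ +-identityˡ (h j) ⟩
    h j          ∎
    where
    below-j≗0 : ∀ r → r < j → h r ≡ 0ℚ
    below-j≗0 r r<j = others≗0 r (ℕₚ.m<n⇒m<1+n r<j) (ℕₚ.<⇒≢ r<j)
  ... | no j≢n = begin
    ∑ n h + h n  ≡⟨ cong₂ _+_ (∑-single n h j j<n (λ r r<n → others≗0 r (ℕₚ.m<n⇒m<1+n r<n)))
                              (others≗0 n (ℕₚ.n<1+n n) (j≢n ∘ sym)) ⟩
    h j + 0ℚ     ≡⟨ +-identityʳ (h j) ⟩
    h j          ∎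
    where j<n = ℕₚ.≤∧≢⇒< (ℕₚ.≤-pred j<1+n) j≢n

module Punching where
  open import Data.Nat as ℕ using (ℕ; zero; suc; _<_; _≤_; s≤s)
  import Data.Nat.Properties as ℕₚ
  open import Data.Rational using (ℚ; 1ℚ; _+_; _*_; -_)
  open import Data.Rational.Solver using (module +-*-Solver)
  open +-*-Solver
  open import Data.Empty using (⊥-elim)
  open import Data.Sum using (inj₁; inj₂)
  open Summation
  open ≡-Reasoning

  punchInℕ : ℕ → ℕ → ℕ
  punchInℕ zero    k       = suc k
  punchInℕ (suc j) zero    = zero
  punchInℕ (suc j) (suc k) = suc (punchInℕ j k)

  punchOutℕ : ℕ → ℕ → ℕ
  punchOutℕ zero    zero    = zero
  punchOutℕ zero    (suc b) = b
  punchOutℕ (suc a) zero    = zero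
  punchOutℕ (suc a) (suc b) = suc (punchOutℕ a b)

  punchOutℕ-punchInℕ : ∀ a k → punchOutℕ a (punchInℕ a k) ≡ k
  punchOutℕ-punchInℕ zero    k       = refl
  punchOutℕ-punchInℕ (suc a) zero    = refl
  punchOutℕ-punchInℕ (suc a) (suc k) = cong suc (punchOutℕ-punchInℕ a k)

  punchInℕ-≥ : ∀ a k → a ≤ k → punchInℕ a k ≡ suc k
  punchInℕ-≥ zero    k       _         = refl
  punchInℕ-≥ (suc a) (suc k) (s≤s a≤k) = cong suc (punchInℕ-≥ a k a≤k)

  punchInℕ-< : ∀ a k → k < a → punchInℕ a k ≡ k
  punchInℕ-< (suc a) zero    _         = refl
  punchInℕ-< (suc a) (suc k) (s≤s k<a) = cong suc (punchInℕ-< a k k<a)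

  punchInℕ≢ : ∀ a k → a ≢ punchInℕ a k
  punchInℕ≢ zero    k       ()
  punchInℕ≢ (suc a) zero    ()
  punchInℕ≢ (suc a) (suc k) eq = punchInℕ≢ a k (ℕₚ.suc-injective eq)

  punchInℕ-punchInℕ-comm : ∀ a b l → a ≢ b →
    punchInℕ a (punchInℕ (punchOutℕ a b) l) ≡ punchInℕ b (punchInℕ (punchOutℕ b a) l)
  punchInℕ-punchInℕ-comm zero    zero    l       a≢b = ⊥-elim (a≢b refl)
  punchInℕ-punchInℕ-comm zero    (suc b) l       a≢b = refl
  punchInℕ-punchInℕ-comm (suc a) zero    l       a≢b = refl
  punchInℕ-punchInℕ-comm (suc a) (suc b) zero    a≢b = refl
  punchInℕ-punchInℕ-comm (suc a) (suc b) (suc l) a≢b =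
    cong suc (punchInℕ-punchInℕ-comm a b l (a≢b ∘ cong suc))

  ∑-punchInℕ : ∀ n a (F : ℕ → ℚ) → a ≤ n → ∑[ k < n ] F (punchInℕ a k) + F a ≡ ∑ (suc n) F
  ∑-punchInℕ zero    zero F _ = refl
  ∑-punchInℕ (suc n) a F a≤1+n with ℕₚ.m≤n⇒m<n∨m≡n a≤1+n
  ... | inj₁ (s≤s a≤n) = begin
    (∑[ k < n ] F (punchInℕ a k) + F (punchInℕ a n)) + F a
      ≡⟨ cong (λ t → (∑[ k < n ] F (punchInℕ a k) + F t) + F a) (punchInℕ-≥ a n a≤n) ⟩
    (∑[ k < n ] F (punchInℕ a k) + F (suc n)) + F a
      ≡⟨ solve 3 (λ S x y → (S :+ x) :+ y := (S :+ y) :+ x) refl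
           (∑[ k < n ] F (punchInℕ a k)) (F (suc n)) (F a) ⟩
    (∑[ k < n ] F (punchInℕ a k) + F a) + F (suc n)
      ≡⟨ cong (_+ F (suc n)) (∑-punchInℕ n a F a≤n) ⟩
    ∑ (suc n) F + F (suc n) ∎
  ... | inj₂ refl =
    cong (_+ F (suc n)) (∑-cong (suc n) (λ k k<1+n → cong F (punchInℕ-< (suc n) k k<1+n)))

  sign : ℕ → ℚ
  sign zero    = 1ℚ
  sign (suc k) = - sign k

  sign-punchOutℕ-antisym : ∀ a b → a ≢ b →
    sign b * sign (punchOutℕ b a) ≡ - (sign a * sign (punchOutℕ a b))
  sign-punchOutℕ-antisym zero    zero    a≢b = ⊥-elim (a≢b refl)
  sign-punchOutℕ-antisym zero    (suc b) a≢b =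
    solve 1 (λ x → (:- x) :* con 1ℚ := :- (con 1ℚ :* x)) refl (sign b)
  sign-punchOutℕ-antisym (suc a) zero    a≢b =
    solve 1 (λ x → con 1ℚ :* x := :- ((:- x) :* con 1ℚ)) refl (sign a)
  sign-punchOutℕ-antisym (suc a) (suc b) a≢b = begin
    - sign b * - sign (punchOutℕ b a)     ≡⟨ neg-neg (sign b) (sign (punchOutℕ b a)) ⟩
    sign b * sign (punchOutℕ b a)         ≡⟨ sign-punchOutℕ-antisym a b (a≢b ∘ cong suc) ⟩
    - (sign a * sign (punchOutℕ a b))     ≡⟨ cong -_ (neg-neg (sign a) (sign (punchOutℕ a b))) ⟨
    - (- sign a * - sign (punchOutℕ a b)) ∎
    where
    neg-neg : ∀ x y → - x * - y ≡ x * y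
    neg-neg = solve 2 (λ x y → (:- x) :* (:- y) := x :* y) refl

module Determinant where
  open import Data.Nat as ℕ using (ℕ; zero; suc; _<_; _≡ᵇ_; s≤s; z<s)
  import Data.Nat.Properties as ℕₚ
  open import Data.Bool using (true; false; if_then_else_)
  open import Data.Rational using (ℚ; 0ℚ; 1ℚ; ½; _+_; _*_; -_)
  open import Data.Rational.Properties using (*-zeroʳ; +-identityʳ; +-inverseʳ; neg-distribˡ-*)
  open import Data.Rational.Solver using (module +-*-Solver)
  open +-*-Solver
  open import Data.Empty using (⊥-elim)
  open import Relation.Binary using (tri<; tri≈; tri>)
  open import Relation.Nullary using (yes; no)
  open import Relation.Nullary.Decidable using (dec-true; dec-false)
  open Summation
  open Punching
  open ≡-Reasoning

  Matrix : Set
  Matrix = ℕ → ℕ → ℚ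

  minor : ℕ → Matrix → Matrix
  minor a M i k = M (suc i) (punchInℕ a k)

  -- ℕ-indexed, so that minors need no bounds; detℚ n M reads only the top-left n × n block of M.
  detℚ : ℕ → Matrix → ℚ
  detℚ zero    M = 1ℚ
  detℚ (suc n) M = ∑[ a < suc n ] (sign a * (M 0 a * detℚ n (minor a M)))

  detℚ-cong : ∀ n {M N : Matrix} → (∀ i k → M i k ≡ N i k) → detℚ n M ≡ detℚ n N
  detℚ-cong zero    M≗N = refl
  detℚ-cong (suc n) M≗N = ∑-cong (suc n) (λ a _ → cong (sign a *_)
    (cong₂ _*_ (M≗N 0 a) (detℚ-cong n (λ i k → M≗N (suc i) (punchInℕ a k)))))

  replaceRow : Matrix → ℕ → (ℕ → ℚ) → Matrix
  replaceRow M j w i k = if i ≡ᵇ j then w k else M i k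

  detℚ-replaceRow-∑ : ∀ n M j K (x : ℕ → ℚ) (S : Matrix) → j < n →
    detℚ n (replaceRow M j (λ c → ∑[ r < K ] (x r * S r c)))
      ≡ ∑[ r < K ] (x r * detℚ n (replaceRow M j (S r)))
  detℚ-replaceRow-∑ (suc n) M zero K x S _ = begin
    ∑[ a < suc n ] (sign a * (∑[ r < K ] (x r * S r a) * D a))
      ≡⟨ ∑-cong (suc n) (λ a _ → pull a) ⟩
    ∑[ a < suc n ] ∑[ r < K ] (x r * (sign a * (S r a * D a)))
      ≡⟨ ∑-swap (suc n) K _ ⟩
    ∑[ r < K ] ∑[ a < suc n ] (x r * (sign a * (S r a * D a)))
      ≡⟨ ∑-cong K (λ r _ → ∑-*ˡ (suc n) (x r) _) ⟩
    ∑[ r < K ] (x r * ∑[ a < suc n ] (sign a * (S r a * D a))) ∎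
    where
    D : ℕ → ℚ
    D a = detℚ n (minor a M)
    pull : ∀ a → sign a * (∑[ r < K ] (x r * S r a) * D a)
               ≡ ∑[ r < K ] (x r * (sign a * (S r a * D a)))
    pull a = begin
      sign a * (∑[ r < K ] (x r * S r a) * D a)
        ≡⟨ solve 3 (λ s W d → s :* (W :* d) := (s :* d) :* W) refl (sign a) _ (D a) ⟩
      (sign a * D a) * ∑[ r < K ] (x r * S r a)
        ≡⟨ ∑-*ˡ K (sign a * D a) _ ⟨
      ∑[ r < K ] ((sign a * D a) * (x r * S r a))
        ≡⟨ ∑-cong K (λ r _ → solve 4 (λ s d y z → (s :* d) :* (y :* z) := y :* (s :* (z :* d))) refl
                                (sign a) (D a) (x r) (S r a)) ⟩
      ∑[ r < K ] (x r * (sign a * (S r a * D a))) ∎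
  detℚ-replaceRow-∑ (suc n) M (suc j) K x S (s≤s j<n) = begin
    ∑[ a < suc n ] (sign a * (M 0 a * detℚ n (replaceRow (minor a M) j (λ c → ∑[ r < K ] (x r * S′ a r c)))))
      ≡⟨ ∑-cong (suc n) (λ a _ → cong (λ t → sign a * (M 0 a * t))
                                      (detℚ-replaceRow-∑ n (minor a M) j K x (S′ a) j<n)) ⟩
    ∑[ a < suc n ] (sign a * (M 0 a * ∑[ r < K ] (x r * D a r)))
      ≡⟨ ∑-cong (suc n) (λ a _ → pull a) ⟩
    ∑[ a < suc n ] ∑[ r < K ] (x r * (sign a * (M 0 a * D a r)))
      ≡⟨ ∑-swap (suc n) K _ ⟩
    ∑[ r < K ] ∑[ a < suc n ] (x r * (sign a * (M 0 a * D a r)))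
      ≡⟨ ∑-cong K (λ r _ → ∑-*ˡ (suc n) (x r) _) ⟩
    ∑[ r < K ] (x r * ∑[ a < suc n ] (sign a * (M 0 a * D a r))) ∎
    where
    S′ : ℕ → Matrix
    S′ a r c = S r (punchInℕ a c)
    D : ℕ → ℕ → ℚ
    D a r = detℚ n (replaceRow (minor a M) j (S′ a r))
    pull : ∀ a → sign a * (M 0 a * ∑[ r < K ] (x r * D a r))
               ≡ ∑[ r < K ] (x r * (sign a * (M 0 a * D a r)))
    pull a = begin
      sign a * (M 0 a * ∑[ r < K ] (x r * D a r))
        ≡⟨ solve 3 (λ s m W → s :* (m :* W) := (s :* m) :* W) refl (sign a) (M 0 a) _ ⟩
      (sign a * M 0 a) * ∑[ r < K ] (x r * D a r)
        ≡⟨ ∑-*ˡ K (sign a * M 0 a) _ ⟨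
      ∑[ r < K ] ((sign a * M 0 a) * (x r * D a r))
        ≡⟨ ∑-cong K (λ r _ → solve 4 (λ s m y d → (s :* m) :* (y :* d) := y :* (s :* (m :* d))) refl
                                (sign a) (M 0 a) (x r) (D a r)) ⟩
      ∑[ r < K ] (x r * (sign a * (M 0 a * D a r))) ∎

  swap₀₁ : Matrix → Matrix
  swap₀₁ M zero          = M 1
  swap₀₁ M (suc zero)    = M 0
  swap₀₁ M (suc (suc i)) = M (suc (suc i))

  minor₂ : ℕ → ℕ → Matrix → Matrix
  minor₂ a b M = minor (punchOutℕ a b) (minor a M)

  -- The coefficient of M 0 a · M 1 b in the Laplace expansion of detℚ (2 + n) M along its first two rows.
  cofactor₂ : Matrix → ℕ → ℕ → ℕ → ℚ
  cofactor₂ M n a b = if a ≡ᵇ b then 0ℚ else (sign a * sign (punchOutℕ a b)) * detℚ n (minor₂ a b M)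

  detℚ-expand₂ : ∀ n M → detℚ (suc (suc n)) M
    ≡ ∑[ a < suc (suc n) ] ∑[ b < suc (suc n) ] ((M 0 a * M 1 b) * cofactor₂ M n a b)
  detℚ-expand₂ n M = ∑-cong (suc (suc n)) expandRow
    where
    second-row : ℕ → ℕ → ℚ
    second-row a b = if a ≡ᵇ b then 0ℚ else sign (punchOutℕ a b) * (M 1 b * detℚ n (minor₂ a b M))
    second-row-punchIn : ∀ a k →
      sign k * (M 1 (punchInℕ a k) * detℚ n (minor k (minor a M))) ≡ second-row a (punchInℕ a k)
    second-row-punchIn a k
      rewrite dec-false (a ℕ.≟ punchInℕ a k) (punchInℕ≢ a k) | punchOutℕ-punchInℕ a k = refl
    second-row-diag : ∀ a → second-row a a ≡ 0ℚ
    second-row-diag a rewrite dec-true (a ℕ.≟ a) refl = refl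
    regroup : ∀ a b → sign a * (M 0 a * second-row a b) ≡ (M 0 a * M 1 b) * cofactor₂ M n a b
    regroup a b with a ≡ᵇ b
    ... | true  = solve 3 (λ s x y → s :* (x :* con 0ℚ) := (x :* y) :* con 0ℚ) refl (sign a) (M 0 a) (M 1 b)
    ... | false = solve 5 (λ s x t y d → s :* (x :* (t :* (y :* d))) := (x :* y) :* ((s :* t) :* d)) refl
                    (sign a) (M 0 a) (sign (punchOutℕ a b)) (M 1 b) (detℚ n (minor₂ a b M))
    expandRow : ∀ a → a < suc (suc n) → sign a * (M 0 a * detℚ (suc n) (minor a M))
      ≡ ∑[ b < suc (suc n) ] ((M 0 a * M 1 b) * cofactor₂ M n a b)
    expandRow a (s≤s a≤1+n) = begin
      sign a * (M 0 a * detℚ (suc n) (minor a M))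
        ≡⟨ cong (λ t → sign a * (M 0 a * t)) minor-as-row-sum ⟩
      sign a * (M 0 a * ∑ (suc (suc n)) (second-row a))
        ≡⟨ cong (sign a *_) (∑-*ˡ (suc (suc n)) (M 0 a) _) ⟨
      sign a * ∑[ b < suc (suc n) ] (M 0 a * second-row a b)
        ≡⟨ ∑-*ˡ (suc (suc n)) (sign a) _ ⟨
      ∑[ b < suc (suc n) ] (sign a * (M 0 a * second-row a b))
        ≡⟨ ∑-cong (suc (suc n)) (λ b _ → regroup a b) ⟩
      ∑[ b < suc (suc n) ] ((M 0 a * M 1 b) * cofactor₂ M n a b) ∎
      where
      minor-as-row-sum : detℚ (suc n) (minor a M) ≡ ∑ (suc (suc n)) (second-row a)
      minor-as-row-sum = begin
        detℚ (suc n) (minor a M)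
          ≡⟨ ∑-cong (suc n) (λ k _ → second-row-punchIn a k) ⟩
        ∑[ k < suc n ] second-row a (punchInℕ a k)
          ≡⟨ +-identityʳ _ ⟨
        ∑[ k < suc n ] second-row a (punchInℕ a k) + 0ℚ
          ≡⟨ cong (∑[ k < suc n ] second-row a (punchInℕ a k) +_) (second-row-diag a) ⟨
        ∑[ k < suc n ] second-row a (punchInℕ a k) + second-row a a
          ≡⟨ ∑-punchInℕ (suc n) a (second-row a) a≤1+n ⟩
        ∑ (suc (suc n)) (second-row a) ∎

  cofactor₂-antisym : ∀ M n a b → cofactor₂ M n b a ≡ - cofactor₂ M n a b
  cofactor₂-antisym M n a b with a ℕ.≟ b
  ... | yes refl rewrite dec-true (a ℕ.≟ a) refl = refl
  ... | no a≢b rewrite dec-false (a ℕ.≟ b) a≢b | dec-false (b ℕ.≟ a) (a≢b ∘ sym) = begin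
    (sign b * sign (punchOutℕ b a)) * detℚ n (minor₂ b a M)
      ≡⟨ cong₂ _*_ (sign-punchOutℕ-antisym a b a≢b) (detℚ-cong n minor₂-sym) ⟩
    - (sign a * sign (punchOutℕ a b)) * detℚ n (minor₂ a b M)
      ≡⟨ neg-distribˡ-* (sign a * sign (punchOutℕ a b)) (detℚ n (minor₂ a b M)) ⟨
    - ((sign a * sign (punchOutℕ a b)) * detℚ n (minor₂ a b M)) ∎
    where
    minor₂-sym : ∀ i l → minor₂ b a M i l ≡ minor₂ a b M i l
    minor₂-sym i l = cong (M (suc (suc i))) (sym (punchInℕ-punchInℕ-comm a b l a≢b))

  detℚ-swap₀₁ : ∀ n M → detℚ (suc (suc n)) (swap₀₁ M) ≡ - detℚ (suc (suc n)) M
  detℚ-swap₀₁ n M = begin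
    detℚ (2+n) (swap₀₁ M)
      ≡⟨ detℚ-expand₂ n (swap₀₁ M) ⟩
    ∑[ a < 2+n ] ∑[ b < 2+n ] ((M 1 a * M 0 b) * cofactor₂ M n a b)
      ≡⟨ ∑-swap 2+n 2+n _ ⟩
    ∑[ b < 2+n ] ∑[ a < 2+n ] ((M 1 a * M 0 b) * cofactor₂ M n a b)
      ≡⟨ ∑-cong 2+n (λ b _ → ∑-cong 2+n (λ a _ → flip a b)) ⟩
    ∑[ b < 2+n ] ∑[ a < 2+n ] (- ((M 0 b * M 1 a) * cofactor₂ M n b a))
      ≡⟨ ∑-cong 2+n (λ b _ → ∑-neg 2+n _) ⟩
    ∑[ b < 2+n ] (- ∑[ a < 2+n ] ((M 0 b * M 1 a) * cofactor₂ M n b a))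
      ≡⟨ ∑-neg 2+n _ ⟩
    - ∑[ b < 2+n ] ∑[ a < 2+n ] ((M 0 b * M 1 a) * cofactor₂ M n b a)
      ≡⟨ cong -_ (detℚ-expand₂ n M) ⟨
    - detℚ (2+n) M ∎
    where
    2+n : ℕ
    2+n = suc (suc n)
    flip : ∀ a b → (M 1 a * M 0 b) * cofactor₂ M n a b ≡ - ((M 0 b * M 1 a) * cofactor₂ M n b a)
    flip a b = begin
      (M 1 a * M 0 b) * cofactor₂ M n a b       ≡⟨ cong ((M 1 a * M 0 b) *_) (cofactor₂-antisym M n b a) ⟩
      (M 1 a * M 0 b) * - cofactor₂ M n b a     ≡⟨ solve 3 (λ x y e → (x :* y) :* (:- e) := :- ((y :* x) :* e)) refl
                                                      (M 1 a) (M 0 b) (cofactor₂ M n b a) ⟩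
      - ((M 0 b * M 1 a) * cofactor₂ M n b a)   ∎

  x≡-x⇒x≡0 : ∀ x → x ≡ - x → x ≡ 0ℚ
  x≡-x⇒x≡0 x x≡-x = begin
    x                ≡⟨ solve 1 (λ x → x := con ½ :* (x :+ x)) refl x ⟩
    ½ * (x + x)      ≡⟨ cong (λ t → ½ * (x + t)) x≡-x ⟩
    ½ * (x + - x)    ≡⟨ cong (½ *_) (+-inverseʳ x) ⟩
    ½ * 0ℚ           ≡⟨ *-zeroʳ ½ ⟩
    0ℚ               ∎

  mutual
    detℚ-equal-rows : ∀ n M r s → r < s → s < n → (∀ c → M r c ≡ M s c) → detℚ n M ≡ 0ℚ
    detℚ-equal-rows (suc n) M (suc r) (suc s) (s≤s r<s) (s≤s s<n) Mr≗Ms =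
      detℚ-equal-rows-below-top n M r s r<s s<n Mr≗Ms
    detℚ-equal-rows (suc (suc n)) M zero (suc zero) _ _ M0≗M1 =
      x≡-x⇒x≡0 _ (trans (detℚ-cong (suc (suc n)) M≗swap) (detℚ-swap₀₁ n M))
      where
      M≗swap : ∀ i k → M i k ≡ swap₀₁ M i k
      M≗swap zero          k = M0≗M1 k
      M≗swap (suc zero)    k = sym (M0≗M1 k)
      M≗swap (suc (suc i)) k = refl
    detℚ-equal-rows (suc (suc n)) M zero (suc (suc s)) _ (s≤s s<1+n) M0≗Ms = begin
      detℚ (suc (suc n)) M
        ≡⟨ solve 1 (λ x → x := :- (:- x)) refl _ ⟩
      - (- detℚ (suc (suc n)) M)
        ≡⟨ cong -_ (detℚ-swap₀₁ n M) ⟨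
      - detℚ (suc (suc n)) (swap₀₁ M)
        ≡⟨ cong -_ (detℚ-equal-rows-below-top (suc n) (swap₀₁ M) zero (suc s) z<s s<1+n M0≗Ms) ⟩
      - 0ℚ ∎
    detℚ-equal-rows (suc zero) M zero (suc s) _ (s≤s ()) _

    detℚ-equal-rows-below-top : ∀ n M r s → r < s → s < n →
      (∀ c → M (suc r) c ≡ M (suc s) c) → detℚ (suc n) M ≡ 0ℚ
    detℚ-equal-rows-below-top n M r s r<s s<n Mr≗Ms = ∑-zero (suc n) _ (λ a _ → begin
      sign a * (M 0 a * detℚ n (minor a M))
        ≡⟨ cong (λ t → sign a * (M 0 a * t)) (detℚ-equal-rows n (minor a M) r s r<s s<n (Mr≗Ms ∘ punchInℕ a)) ⟩
      sign a * (M 0 a * 0ℚ)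
        ≡⟨ solve 2 (λ s x → s :* (x :* con 0ℚ) := con 0ℚ) refl (sign a) (M 0 a) ⟩
      0ℚ ∎)

  cramer : ∀ n (S : Matrix) (x b : ℕ → ℚ) j → j < n →
    (∀ c → ∑[ r < n ] (x r * S r c) ≡ b c) → detℚ n (replaceRow S j b) ≡ x j * detℚ n S
  cramer n S x b j j<n xS≡b = begin
    detℚ n (replaceRow S j b)
      ≡⟨ detℚ-cong n (λ i k → cong (λ w → if i ≡ᵇ j then w else S i k) (xS≡b k)) ⟨
    detℚ n (replaceRow S j (λ c → ∑[ r < n ] (x r * S r c)))
      ≡⟨ detℚ-replaceRow-∑ n S j n x S j<n ⟩
    ∑[ r < n ] (x r * detℚ n (replaceRow S j (S r)))
      ≡⟨ ∑-single n _ j j<n other-rows-vanish ⟩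
    x j * detℚ n (replaceRow S j (S j))
      ≡⟨ cong (x j *_) (detℚ-cong n replaceRow-by-itself) ⟩
    x j * detℚ n S ∎
    where
    replaceRow-by-itself : ∀ i k → replaceRow S j (S j) i k ≡ S i k
    replaceRow-by-itself i k with i ℕ.≟ j
    ... | yes refl rewrite dec-true (i ℕ.≟ i) refl = refl
    ... | no i≢j   rewrite dec-false (i ℕ.≟ j) i≢j = refl
    rows-r-j-equal : ∀ r → r ≢ j → ∀ c → replaceRow S j (S r) r c ≡ replaceRow S j (S r) j c
    rows-r-j-equal r r≢j c rewrite dec-false (r ℕ.≟ j) r≢j | dec-true (j ℕ.≟ j) refl = refl
    other-rows-vanish : ∀ r → r < n → r ≢ j → x r * detℚ n (replaceRow S j (S r)) ≡ 0ℚ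
    other-rows-vanish r r<n r≢j = trans (cong (x r *_) det≡0) (*-zeroʳ (x r))
      where
      det≡0 : detℚ n (replaceRow S j (S r)) ≡ 0ℚ
      det≡0 with ℕₚ.<-cmp r j
      ... | tri< r<j _ _ = detℚ-equal-rows n _ r j r<j j<n (rows-r-j-equal r r≢j)
      ... | tri≈ _ r≡j _ = ⊥-elim (r≢j r≡j)
      ... | tri> _ _ j<r = detℚ-equal-rows n _ j r j<r r<n (sym ∘ rows-r-j-equal r r≢j)

module IntegerDeterminant where
  open import Data.Nat using (ℕ; zero; suc)
  open import Data.Integer as ℤ using (ℤ; +_)
  open import Data.Integer.Divisibility.Signed using (_∣_; divides; ∣m∣n⇒∣m-n; ∣m⇒∣m*n; ∣n⇒∣m*n)
  open import Data.Integer.Properties using (*-zeroˡ)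
  open import Data.Rational using (ℚ; _+_; _*_; -_; _-_)
  open import Data.Rational.Properties using (*-identityˡ; neg-distribˡ-*)
  open import Data.Fin using (Fin; zero; suc; toℕ; punchIn; punchOut)
  import Data.Fin.Properties as Finₚ
  open import Relation.Nullary using (yes; no)
  open ToℚProperties
  open Summation
  open Punching
  open Determinant
  open ≡-Reasoning

  toℕ-punchIn : ∀ {n} (j : Fin (suc n)) (k : Fin n) → toℕ (punchIn j k) ≡ punchInℕ (toℕ j) (toℕ k)
  toℕ-punchIn zero    k       = refl
  toℕ-punchIn (suc j) zero    = refl
  toℕ-punchIn (suc j) (suc k) = cong suc (toℕ-punchIn j k)

  toℚ-altSum : ∀ n (h : Fin n → ℤ) (h′ : ℕ → ℚ) → (∀ j → toℚ (h j) ≡ h′ (toℕ j)) →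
    toℚ (altSum n h) ≡ ∑[ j < n ] (sign j * h′ j)
  toℚ-altSum zero    h h′ h≗h′ = refl
  toℚ-altSum (suc n) h h′ h≗h′ = begin
    toℚ (h zero ℤ.- altSum n (h ∘ suc))
      ≡⟨ toℚ-sub (h zero) (altSum n (h ∘ suc)) ⟩
    toℚ (h zero) - toℚ (altSum n (h ∘ suc))
      ≡⟨ cong₂ _-_ (h≗h′ zero) (toℚ-altSum n (h ∘ suc) (h′ ∘ suc) (h≗h′ ∘ suc)) ⟩
    h′ 0 - ∑[ j < n ] (sign j * h′ (suc j))
      ≡⟨ cong (λ t → h′ 0 + t) (∑-neg n _) ⟨
    h′ 0 + ∑[ j < n ] (- (sign j * h′ (suc j)))
      ≡⟨ cong₂ _+_ (*-identityˡ (h′ 0)) (∑-cong n (λ j _ → sym (neg-distribˡ-* (sign j) (h′ (suc j))))) ⟨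
    sign 0 * h′ 0 + ∑[ j < n ] (sign (suc j) * h′ (suc j))
      ≡⟨ ∑-head n (λ j → sign j * h′ j) ⟨
    ∑[ j < suc n ] (sign j * h′ j) ∎

  toℚ-det : ∀ n (M : Fin n → Fin n → ℤ) (N : Matrix) → (∀ i k → toℚ (M i k) ≡ N (toℕ i) (toℕ k)) →
    toℚ (det n M) ≡ detℚ n N
  toℚ-det zero    M N M≗N = refl
  toℚ-det (suc n) M N M≗N = toℚ-altSum (suc n) term _ toℚ-term
    where
    term : Fin (suc n) → ℤ
    term j = M zero j ℤ.* det n (λ i k → M (suc i) (punchIn j k))
    toℚ-term : ∀ j → toℚ (term j) ≡ N 0 (toℕ j) * detℚ n (minor (toℕ j) N)
    toℚ-term j = begin
      toℚ (M zero j ℤ.* det n (λ i k → M (suc i) (punchIn j k)))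
        ≡⟨ toℚ-* (M zero j) _ ⟩
      toℚ (M zero j) * toℚ (det n (λ i k → M (suc i) (punchIn j k)))
        ≡⟨ cong₂ _*_ (M≗N zero j) (toℚ-det n _ (minor (toℕ j) N) minor≗) ⟩
      N 0 (toℕ j) * detℚ n (minor (toℕ j) N) ∎
      where
      minor≗ : ∀ i k → toℚ (M (suc i) (punchIn j k)) ≡ minor (toℕ j) N (toℕ i) (toℕ k)
      minor≗ i k = trans (M≗N (suc i) (punchIn j k)) (cong (N (suc (toℕ i))) (toℕ-punchIn j k))

  _∣0 : ∀ D → D ∣ + 0
  D ∣0 = divides (+ 0) (sym (*-zeroˡ D))

  altSum-∣ : ∀ n (h : Fin n → ℤ) D → (∀ j → D ∣ h j) → D ∣ altSum n h
  altSum-∣ zero    h D D∣h = D ∣0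
  altSum-∣ (suc n) h D D∣h = ∣m∣n⇒∣m-n (D∣h zero) (altSum-∣ n (h ∘ suc) D (D∣h ∘ suc))

  det-∣-column : ∀ n (M : Fin n → Fin n → ℤ) (c : Fin n) D → (∀ r → D ∣ M r c) → D ∣ det n M
  det-∣-column (suc n) M c D D∣col = altSum-∣ (suc n) _ D D∣term
    where
    D∣term : ∀ j → D ∣ (M zero j ℤ.* det n (λ i k → M (suc i) (punchIn j k)))
    D∣term j with j Finₚ.≟ c
    ... | yes refl = ∣m⇒∣m*n _ (D∣col zero)
    ... | no j≢c   = ∣n⇒∣m*n (M zero j) (det-∣-column n _ (punchOut j≢c) D (λ r →
      subst (λ k → D ∣ M (suc r) k) (sym (Finₚ.punchIn-punchOut j≢c)) (D∣col (suc r))))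

module Denominators where
  open import Data.Nat as ℕ using (ℕ; suc)
  import Data.Nat.Properties as ℕₚ
  open import Data.Nat.Divisibility using (_∣_; divides)
  open import Data.Nat.Coprimality using (coprime-divisor; recompute) renaming (sym to coprime-sym)
  open import Data.Integer as ℤ using (+_; ∣_∣)
  import Data.Integer.Properties as ℤₚ
  open import Data.Rational using (ℚ; mkℚ; 1ℚ; _*_; 1/_; toℚᵘ; NonZero; ≢-nonZero)
  open import Data.Rational.Properties using (*-assoc; *-identityʳ; *-inverseʳ; toℚᵘ-homo-*)
  open import Data.Rational.Unnormalised as ℚᵘ using (*≡*)
  open import Data.Rational.Unnormalised.Properties using (≃-sym; ≃-trans; ≃-reflexive; *-congˡ)
  open ToℚProperties
  open ≡-Reasoning

  toℚ-injective : ∀ {a b} → toℚ a ≡ toℚ b → a ≡ b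
  toℚ-injective {a} {b} a≡b
    with ≃-trans (≃-sym (toℚᵘ-toℚ a)) (≃-trans (≃-reflexive (cong toℚᵘ a≡b)) (toℚᵘ-toℚ b))
  ... | *≡* a*1≡b*1 = trans (sym (ℤₚ.*-identityʳ a)) (trans a*1≡b*1 (ℤₚ.*-identityʳ b))

  *-cancelʳ-≡ : ∀ x y z .{{_ : NonZero z}} → x * z ≡ y * z → x ≡ y
  *-cancelʳ-≡ x y z xz≡yz = begin
    x                 ≡⟨ *-identityʳ x ⟨
    x * 1ℚ            ≡⟨ cong (x *_) (*-inverseʳ z) ⟨
    x * (z * 1/ z)    ≡⟨ *-assoc x z (1/ z) ⟨
    (x * z) * 1/ z    ≡⟨ cong (_* 1/ z) xz≡yz ⟩
    (y * z) * 1/ z    ≡⟨ *-assoc y z (1/ z) ⟩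
    y * (z * 1/ z)    ≡⟨ cong (y *_) (*-inverseʳ z) ⟩
    y * 1ℚ            ≡⟨ *-identityʳ y ⟩
    y                 ∎

  toℚ-*-cancelʳ : ∀ x a b e → e ≢ + 0 → x * toℚ (a ℤ.* e) ≡ toℚ (b ℤ.* e) → x * toℚ a ≡ toℚ b
  toℚ-*-cancelʳ x a b e e≢0 xae≡be = *-cancelʳ-≡ (x * toℚ a) (toℚ b) (toℚ e) {{toℚe-nonZero}} (begin
    (x * toℚ a) * toℚ e   ≡⟨ *-assoc x (toℚ a) (toℚ e) ⟩
    x * (toℚ a * toℚ e)   ≡⟨ cong (x *_) (toℚ-* a e) ⟨
    x * toℚ (a ℤ.* e)     ≡⟨ xae≡be ⟩
    toℚ (b ℤ.* e)         ≡⟨ toℚ-* b e ⟩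
    toℚ b * toℚ e         ∎)
    where
    toℚe-nonZero : NonZero (toℚ e)
    toℚe-nonZero = ≢-nonZero (e≢0 ∘ toℚ-injective)

  -- Writing x = u/v in lowest terms, x·a = b gives u·a = b·v, and v is coprime to u.
  denominator-∣ : ∀ x a b → x * toℚ a ≡ toℚ b → ℚ.denominatorℕ x ∣ ∣ a ∣
  denominator-∣ x@(mkℚ u v-1 u⊥v) a b xa≡b =
    coprime-divisor (coprime-sym (recompute u⊥v)) (divides ∣ b ∣ (begin
      ∣ u ∣ ℕ.* ∣ a ∣     ≡⟨ ℤₚ.abs-* u a ⟨
      ∣ u ℤ.* a ∣         ≡⟨ cong ∣_∣ ua≡bv ⟩
      ∣ b ℤ.* + v ∣       ≡⟨ ℤₚ.abs-* b (+ v) ⟩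
      ∣ b ∣ ℕ.* v         ∎))
    where
    v : ℕ
    v = suc v-1
    xa≃b : toℚᵘ x ℚᵘ.* ℚᵘ.mkℚᵘ a 0 ℚᵘ.≃ ℚᵘ.mkℚᵘ b 0
    xa≃b = ≃-trans (≃-sym (≃-trans (toℚᵘ-homo-* x (toℚ a)) (*-congˡ {toℚᵘ x} (toℚᵘ-toℚ a))))
                   (≃-trans (≃-reflexive (cong toℚᵘ xa≡b)) (toℚᵘ-toℚ b))
    ua≡bv : u ℤ.* a ≡ b ℤ.* + v
    ua≡bv with xa≃b
    ... | *≡* ua*1≡b*v*1 = begin
      u ℤ.* a                     ≡⟨ ℤₚ.*-identityʳ (u ℤ.* a) ⟨
      (u ℤ.* a) ℤ.* + 1           ≡⟨ ua*1≡b*v*1 ⟩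
      b ℤ.* + (v ℕ.* 1)           ≡⟨ cong (λ t → b ℤ.* + t) (ℕₚ.*-identityʳ v) ⟩
      b ℤ.* + v                   ∎

module Sylvester where
  open import Data.Nat as ℕ using (ℕ; zero; suc; _<_; _≤_; _∸_; _≤ᵇ_; _≡ᵇ_; s≤s; z<s)
  import Data.Nat.Properties as ℕₚ
  import Data.Nat.Divisibility as ℕ∣
  open import Data.Nat.LCM using (lcm-least)
  open import Data.Integer as ℤ using (ℤ; +_)
  open import Data.Integer.Divisibility.Signed using (_∣_)
  open import Data.Rational using (ℚ; 0ℚ; _+_; _*_)
  open import Data.Rational.Properties using (*-zeroˡ; *-zeroʳ; +-identityˡ)
  open import Data.Fin using (Fin; toℕ; fromℕ)
  import Data.Fin.Properties as Finₚ
  open import Data.Vec using (Vec; []; _∷_; last; toList)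
  open import Data.Bool using (true; false; if_then_else_)
  open import Data.Sum using (inj₁; inj₂)
  open import Relation.Nullary using (yes; no)
  open import Relation.Nullary.Decidable using (dec-true; dec-false)
  open Summation
  open Determinant
  open IntegerDeterminant
  open Denominators
  open ≡-Reasoning

  coeff-≥ : ∀ {A : Set} (z : A) {k} (v : Vec A k) i → k ≤ i → coeff z v i ≡ z
  coeff-≥ z []      i       _         = refl
  coeff-≥ z (a ∷ v) (suc i) (s≤s k≤i) = coeff-≥ z v i k≤i

  coeff-last : ∀ {A : Set} (z : A) {k} (v : Vec A (suc k)) → coeff z v k ≡ last v
  coeff-last z (a ∷ [])    = refl
  coeff-last z (a ∷ b ∷ v) = coeff-last z (b ∷ v)

  shifted-≤ : ∀ {l} (a : Vec ℤ l) r c → r ≤ c → shifted a r c ≡ coeffℤ a (c ∸ r)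
  shifted-≤ a r c r≤c rewrite dec-true (r ℕ.≤? c) r≤c = refl

  shifted-> : ∀ {l} (a : Vec ℤ l) r c → c < r → shifted a r c ≡ + 0
  shifted-> a r c c<r rewrite dec-false (r ℕ.≤? c) (ℕₚ.<⇒≱ c<r) = refl

  sumTo≡∑ : ∀ c h → sumTo c h ≡ ∑ (suc c) h
  sumTo≡∑ zero    h = sym (+-identityˡ (h 0))
  sumTo≡∑ (suc c) h = cong (_+ h (suc c)) (sumTo≡∑ c h)

  ∑-shifted≡convCoeff : ∀ k (P : ℕ → ℚ) {l} (a : Vec ℤ l) c → (∀ r → k ≤ r → P r ≡ 0ℚ) →
    ∑[ r < k ] (P r * toℚ (shifted a r c)) ≡ convCoeff P (λ i → toℚ (coeffℤ a i)) c
  ∑-shifted≡convCoeff k P a c P-vanishes = begin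
    ∑ k h                                          ≡⟨ ∑-vanishing-tail k (suc c) h beyond-k ⟨
    ∑ (k ℕ.+ suc c) h                              ≡⟨ cong (λ t → ∑ t h) (ℕₚ.+-comm k (suc c)) ⟩
    ∑ (suc c ℕ.+ k) h                              ≡⟨ ∑-vanishing-tail (suc c) k h beyond-c ⟩
    ∑ (suc c) h                                    ≡⟨ ∑-cong (suc c) up-to-c ⟩
    ∑[ i < suc c ] (P i * toℚ (coeffℤ a (c ∸ i)))  ≡⟨ sumTo≡∑ c _ ⟨
    convCoeff P (λ i → toℚ (coeffℤ a i)) c         ∎
    where
    h : ℕ → ℚ
    h r = P r * toℚ (shifted a r c)
    beyond-k : ∀ r → k ≤ r → h r ≡ 0ℚ
    beyond-k r k≤r = trans (cong (_* toℚ (shifted a r c)) (P-vanishes r k≤r)) (*-zeroˡ (toℚ (shifted a r c)))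
    beyond-c : ∀ r → suc c ≤ r → h r ≡ 0ℚ
    beyond-c r c<r = trans (cong (λ t → P r * toℚ t) (shifted-> a r c c<r)) (*-zeroʳ (P r))
    up-to-c : ∀ i → i < suc c → h i ≡ P i * toℚ (coeffℤ a (c ∸ i))
    up-to-c i i≤c = cong (λ t → P i * toℚ t) (shifted-≤ a i c (ℕₚ.≤-pred i≤c))

  -- Defs.sylvester f g i k unfolds to sylvesterℕ f g (toℕ i) (toℕ k).
  sylvesterℕ : ∀ {m n} → Vec ℤ (suc m) → Vec ℤ (suc n) → ℕ → ℕ → ℤ
  sylvesterℕ {m} {n} f g r c = if suc r ≤ᵇ n then shifted f r c else shifted g (r ∸ n) c

  sylvesterℕ-< : ∀ {m n} (f : Vec ℤ (suc m)) (g : Vec ℤ (suc n)) r c → r < n →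
    sylvesterℕ f g r c ≡ shifted f r c
  sylvesterℕ-< {n = n} f g r c r<n rewrite dec-true (suc r ℕ.≤? n) r<n = refl

  sylvesterℕ-≥ : ∀ {m n} (f : Vec ℤ (suc m)) (g : Vec ℤ (suc n)) r c → n ≤ r →
    sylvesterℕ f g r c ≡ shifted g (r ∸ n) c
  sylvesterℕ-≥ {n = n} f g r c n≤r rewrite dec-false (suc r ℕ.≤? n) (ℕₚ.<⇒≱ (s≤s n≤r)) = refl

  bezoutVector : ∀ {m n} → Vec ℚ n → Vec ℚ m → ℕ → ℚ
  bezoutVector {m} {n} p q r = if suc r ≤ᵇ n then coeffℚ p r else coeffℚ q (r ∸ n)

  bezoutVector-< : ∀ {m n} (p : Vec ℚ n) (q : Vec ℚ m) r → r < n → bezoutVector p q r ≡ coeffℚ p r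
  bezoutVector-< {n = n} p q r r<n rewrite dec-true (suc r ℕ.≤? n) r<n = refl

  bezoutVector-+ : ∀ {m n} (p : Vec ℚ n) (q : Vec ℚ m) r → bezoutVector p q (n ℕ.+ r) ≡ coeffℚ q r
  bezoutVector-+ {n = n} p q r
    rewrite dec-false (suc (n ℕ.+ r) ℕ.≤? n) (ℕₚ.<⇒≱ (s≤s (ℕₚ.m≤m+n n r))) | ℕₚ.m+n∸m≡n n r = refl

  bezout⇒linear-system : ∀ {m n} (f : Vec ℤ (suc m)) (g : Vec ℤ (suc n)) (p : Vec ℚ n) (q : Vec ℚ m) →
    IsBezout f g p q → ∀ c → ∑[ r < n ℕ.+ m ] (bezoutVector p q r * toℚ (sylvesterℕ f g r c)) ≡ oneCoeff c
  bezout⇒linear-system {m} {n} f g p q pf+qg≡1 c = begin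
    ∑[ r < n ℕ.+ m ] (bezoutVector p q r * toℚ (sylvesterℕ f g r c))
      ≡⟨ ∑-split n m _ ⟩
    ∑[ r < n ] (bezoutVector p q r * toℚ (sylvesterℕ f g r c))
      + ∑[ r < m ] (bezoutVector p q (n ℕ.+ r) * toℚ (sylvesterℕ f g (n ℕ.+ r) c))
      ≡⟨ cong₂ _+_ (∑-cong n f-rows) (∑-cong m g-rows) ⟩
    ∑[ r < n ] (coeffℚ p r * toℚ (shifted f r c)) + ∑[ r < m ] (coeffℚ q r * toℚ (shifted g r c))
      ≡⟨ cong₂ _+_ (∑-shifted≡convCoeff n (coeffℚ p) f c (coeff-≥ 0ℚ p))
                   (∑-shifted≡convCoeff m (coeffℚ q) g c (coeff-≥ 0ℚ q)) ⟩
    convCoeff (coeffℚ p) (λ i → toℚ (coeffℤ f i)) c + convCoeff (coeffℚ q) (λ i → toℚ (coeffℤ g i)) c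
      ≡⟨ pf+qg≡1 c ⟩
    oneCoeff c ∎
    where
    f-rows : ∀ r → r < n → bezoutVector p q r * toℚ (sylvesterℕ f g r c) ≡ coeffℚ p r * toℚ (shifted f r c)
    f-rows r r<n = cong₂ (λ x y → x * toℚ y) (bezoutVector-< p q r r<n) (sylvesterℕ-< f g r c r<n)
    g-rows : ∀ r → r < m →
      bezoutVector p q (n ℕ.+ r) * toℚ (sylvesterℕ f g (n ℕ.+ r) c) ≡ coeffℚ q r * toℚ (shifted g r c)
    g-rows r _ = cong₂ (λ x y → x * toℚ y) (bezoutVector-+ p q r)
      (trans (sylvesterℕ-≥ f g (n ℕ.+ r) c (ℕₚ.m≤m+n n r)) (cong (λ t → shifted g t c) (ℕₚ.m+n∸m≡n n r)))

  oneCoeffℤ : ℕ → ℤ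
  oneCoeffℤ zero    = + 1
  oneCoeffℤ (suc _) = + 0

  toℚ-oneCoeffℤ : ∀ c → toℚ (oneCoeffℤ c) ≡ oneCoeff c
  toℚ-oneCoeffℤ zero    = refl
  toℚ-oneCoeffℤ (suc c) = refl

  sylvesterUnitRow : ∀ {m n} → Vec ℤ (suc m) → Vec ℤ (suc n) → ℕ → Fin (n ℕ.+ m) → Fin (n ℕ.+ m) → ℤ
  sylvesterUnitRow f g j i k = if toℕ i ≡ᵇ j then oneCoeffℤ (toℕ k) else sylvester f g i k

  cramer-sylvester : ∀ {m n} (f : Vec ℤ (suc m)) (g : Vec ℤ (suc n)) (p : Vec ℚ n) (q : Vec ℚ m) →
    IsBezout f g p q → ∀ j → j < n ℕ.+ m →
    toℚ (det (n ℕ.+ m) (sylvesterUnitRow f g j)) ≡ bezoutVector p q j * toℚ (Res f g)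
  cramer-sylvester {m} {n} f g p q pf+qg≡1 j j<n+m = begin
    toℚ (det (n ℕ.+ m) (sylvesterUnitRow f g j))
      ≡⟨ toℚ-det (n ℕ.+ m) _ (replaceRow S j oneCoeff) unitRow ⟩
    detℚ (n ℕ.+ m) (replaceRow S j oneCoeff)
      ≡⟨ cramer (n ℕ.+ m) S (bezoutVector p q) oneCoeff j j<n+m (bezout⇒linear-system f g p q pf+qg≡1) ⟩
    bezoutVector p q j * detℚ (n ℕ.+ m) S
      ≡⟨ cong (bezoutVector p q j *_) (toℚ-det (n ℕ.+ m) (sylvester f g) S (λ _ _ → refl)) ⟨
    bezoutVector p q j * toℚ (Res f g) ∎
    where
    S : Matrix
    S r c = toℚ (sylvesterℕ f g r c)
    unitRow : ∀ i k → toℚ (sylvesterUnitRow f g j i k) ≡ replaceRow S j oneCoeff (toℕ i) (toℕ k)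
    unitRow i k with toℕ i ≡ᵇ j
    ... | true  = toℚ-oneCoeffℤ (toℕ k)
    ... | false = refl

  shifted-∣ : ∀ D {k} (a : Vec ℤ (suc k)) r c → r ℕ.+ k ≤ c → D ∣ last a → D ∣ shifted a r c
  shifted-∣ D {k} a r c r+k≤c D∣La rewrite shifted-≤ a r c (ℕₚ.m+n≤o⇒m≤o r r+k≤c)
    with ℕₚ.m≤n⇒m<n∨m≡n (ℕₚ.m+n≤o⇒m≤o∸n k (subst (_≤ c) (ℕₚ.+-comm r k) r+k≤c))
  ... | inj₁ k<c∸r = subst (D ∣_) (sym (coeff-≥ (+ 0) a (c ∸ r) k<c∸r)) (D ∣0)
  ... | inj₂ refl  = subst (D ∣_) (sym (coeff-last (+ 0) a)) D∣La

  lastColumn-∣ : ∀ {m n} D (f : Vec ℤ (suc (suc m))) (g : Vec ℤ (suc (suc n))) → D ∣ L f → D ∣ L g →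
    ∀ r → r < suc n ℕ.+ suc m → D ∣ sylvesterℕ f g r (n ℕ.+ suc m)
  lastColumn-∣ {m} {n} D f g D∣Lf D∣Lg r r<N with r ℕ.<? suc n
  ... | yes r<1+n rewrite sylvesterℕ-< f g r (n ℕ.+ suc m) r<1+n =
    shifted-∣ D f r _ (ℕₚ.+-monoˡ-≤ (suc m) (ℕₚ.≤-pred r<1+n)) D∣Lf
  ... | no r≮1+n rewrite sylvesterℕ-≥ f g r (n ℕ.+ suc m) (ℕₚ.≮⇒≥ r≮1+n) =
    shifted-∣ D g (r ∸ suc n) _ g-row-in-range D∣Lg
    where
    g-row-in-range : r ∸ suc n ℕ.+ suc n ≤ n ℕ.+ suc m
    g-row-in-range = ℕₚ.≤-trans (ℕₚ.+-monoˡ-≤ (suc n) (ℕₚ.≤-pred (ℕₚ.m<n+o⇒m∸n<o r (suc n) r<N)))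
      (ℕₚ.≤-reflexive (trans (ℕₚ.+-comm m (suc n)) (sym (ℕₚ.+-suc n m))))

  Res-∣ : ∀ {m n} D (f : Vec ℤ (suc (suc m))) (g : Vec ℤ (suc (suc n))) → D ∣ L f → D ∣ L g → D ∣ Res f g
  Res-∣ {m} {n} D f g D∣Lf D∣Lg = det-∣-column _ (sylvester f g) (fromℕ (n ℕ.+ suc m)) D (λ r →
    subst (λ c → D ∣ sylvesterℕ f g (toℕ r) c) (sym (Finₚ.toℕ-fromℕ _))
          (lastColumn-∣ D f g D∣Lf D∣Lg (toℕ r) (Finₚ.toℕ<n r)))

  sylvesterUnitRow-∣ : ∀ {m n} D (f : Vec ℤ (suc (suc m))) (g : Vec ℤ (suc (suc n))) → D ∣ L f → D ∣ L g →
    ∀ j → D ∣ det _ (sylvesterUnitRow f g j)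
  sylvesterUnitRow-∣ {m} {n} D f g D∣Lf D∣Lg j = det-∣-column _ (sylvesterUnitRow f g j) lastColumn D lastEntry
    where
    lastColumn : Fin (suc n ℕ.+ suc m)
    lastColumn = fromℕ (n ℕ.+ suc m)
    lastEntry : ∀ r → D ∣ sylvesterUnitRow f g j r lastColumn
    lastEntry r rewrite Finₚ.toℕ-fromℕ (n ℕ.+ suc m) with toℕ r ≡ᵇ j
    ... | true  = subst (λ c → D ∣ oneCoeffℤ c) (sym (ℕₚ.+-suc n m)) (D ∣0)
    ... | false = lastColumn-∣ D f g D∣Lf D∣Lg (toℕ r) (Finₚ.toℕ<n r)

  lcmDen-∣ : ∀ {k} (v : Vec ℚ k) A → (∀ i → i < k → ℚ.denominatorℕ (coeffℚ v i) ℕ∣.∣ A) →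
    lcmDen (toList v) ℕ∣.∣ A
  lcmDen-∣ []      A den∣A = ℕ∣.1∣ A
  lcmDen-∣ (x ∷ v) A den∣A = lcm-least (den∣A 0 z<s) (lcmDen-∣ v A (λ i i<k → den∣A (suc i) (s≤s i<k)))

  B-∣ : ∀ {m n} (p : Vec ℚ n) (q : Vec ℚ m) A →
    (∀ j → j < n ℕ.+ m → ℚ.denominatorℕ (bezoutVector p q j) ℕ∣.∣ A) → B p q ℕ∣.∣ A
  B-∣ {m} {n} p q A den∣A = lcm-least
    (lcmDen-∣ p A (λ i i<n → subst (λ x → ℚ.denominatorℕ x ℕ∣.∣ A) (bezoutVector-< p q i i<n)
                                   (den∣A i (ℕₚ.<-≤-trans i<n (ℕₚ.m≤m+n n m)))))
    (lcmDen-∣ q A (λ i i<m → subst (λ x → ℚ.denominatorℕ x ℕ∣.∣ A) (bezoutVector-+ p q i)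
                                   (den∣A (n ℕ.+ i) (ℕₚ.+-monoʳ-< n i<m))))

  bezoutVector-denominator-∣ : ∀ {m n} D (f : Vec ℤ (suc (suc m))) (g : Vec ℤ (suc (suc n))) p q →
    IsBezout f g p q → D ≢ + 0 → D ∣ L f → D ∣ L g → ∀ A → Res f g ≡ A ℤ.* D →
    ∀ j → j < suc n ℕ.+ suc m → ℚ.denominatorℕ (bezoutVector p q j) ℕ∣.∣ ℤ.∣ A ∣
  bezoutVector-denominator-∣ D f g p q pf+qg≡1 D≢0 D∣Lf D∣Lg A Res≡A*D j j<N =
    denominator-∣ x A b (toℚ-*-cancelʳ x A b D D≢0 (begin
      x * toℚ (A ℤ.* D)                   ≡⟨ cong (λ t → x * toℚ t) Res≡A*D ⟨
      x * toℚ (Res f g)                   ≡⟨ cramer-sylvester f g p q pf+qg≡1 j j<N ⟨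
      toℚ (det _ (sylvesterUnitRow f g j)) ≡⟨ cong toℚ detT≡b*D ⟩
      toℚ (b ℤ.* D)                       ∎))
    where
    x : ℚ
    x = bezoutVector p q j
    open _∣_ (sylvesterUnitRow-∣ D f g D∣Lf D∣Lg j) renaming (quotient to b; equality to detT≡b*D)

open import Data.Nat using (ℕ; suc; _+_; _*_; _<_; _≤_; s≤s; z≤n)
open import Data.Nat.Properties using (*-comm)
open import Data.Nat.Divisibility using (_∣_; *-monoˡ-∣; module ∣-Reasoning)
open import Data.Nat.GCD using (gcd; gcd[m,n]∣m; gcd[m,n]∣n; gcd[m,n]≡0⇒m≡0)
open import Data.Integer as ℤ using (ℤ; +_; ∣_∣)
open import Data.Integer.Properties using (abs-*; ∣i∣≡0⇒i≡0)
open import Data.Integer.Divisibility.Signed as ℤ∣ using (∣ᵤ⇒∣)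
open import Data.Rational using (ℚ)
open import Data.Vec using (Vec)
open Sylvester using (bezoutVector; Res-∣; B-∣; bezoutVector-denominator-∣)

theorem5p1 : ∀ {m n} (f : Vec ℤ (suc m)) (g : Vec ℤ (suc n)) →
    1 ≤ m → 1 ≤ n →
    L f ≢ + 0 → L g ≢ + 0 →
    R f g ≢ 0 →
    (p : Vec ℚ n) (q : Vec ℚ m) → IsBezout f g p q →
    (gcd (∣ L f ∣) (∣ L g ∣) * B p q) ∣ R f g
theorem5p1 {suc m} {suc n} f g (s≤s z≤n) (s≤s z≤n) Lf≢0 _ _ p q pf+qg≡1 = begin
  d * B p q            ≡⟨ *-comm d (B p q) ⟩
  B p q * d            ∣⟨ *-monoˡ-∣ d (B-∣ p q ∣ A ∣ denominators-∣) ⟩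
  ∣ A ∣ * d            ≡⟨ abs-* A (+ d) ⟨
  ∣ A ℤ.* + d ∣        ≡⟨ cong ∣_∣ Res≡A*d ⟨
  R f g                ∎
  where
  open ∣-Reasoning
  d : ℕ
  d = gcd ∣ L f ∣ ∣ L g ∣
  d∣Lf : + d ℤ∣.∣ L f
  d∣Lf = ∣ᵤ⇒∣ (gcd[m,n]∣m ∣ L f ∣ ∣ L g ∣)
  d∣Lg : + d ℤ∣.∣ L g
  d∣Lg = ∣ᵤ⇒∣ (gcd[m,n]∣n ∣ L f ∣ ∣ L g ∣)
  d≢0 : + d ≢ + 0
  d≢0 d≡0 = Lf≢0 (∣i∣≡0⇒i≡0 (gcd[m,n]≡0⇒m≡0 (cong ∣_∣ d≡0)))
  open ℤ∣._∣_ (Res-∣ (+ d) f g d∣Lf d∣Lg) renaming (quotient to A; equality to Res≡A*d)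
  denominators-∣ : ∀ j → j < suc n + suc m → ℚ.denominatorℕ (bezoutVector p q j) ∣ ∣ A ∣
  denominators-∣ = bezoutVector-denominator-∣ (+ d) f g p q pf+qg≡1 d≢0 d∣Lf d∣Lg A Res≡A*d
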